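{- Let $\Gamma=R_n(a,r)$ with $n$ even, and suppose one of the following holds: (i) $a,r$ are even, $2a\not\equiv0\pmod n$ and $4r\not\equiv0\pmod n$; (ii) $a$ is odd and $4a\not\equiv0\pmod n$; (iii) $a$ is odd, $4a\equiv0\pmod n$, $2a\not\equiv0\pmod n$ and $r$ is even. Let $S_1=\{u_{i,j}: i\equiv j\pmod 2\}$ and $S_2=\{u_{i,j}: i\not\equiv j\pmod 2\}$. Then the only automorphism of $\Gamma\times\mathbf{K}_2$ that fixes every vertex of $S_1$ and maps $S_2$ onto itself is the identity.
   Context: For $n\ge3$ and nonzero $a,r\in\mathbb{Z}_n$ (regarded as integers in $\{1,\dots,n-1\}$), $R_n(a,r)$ has vertex set $\{u_i,v_i: i\in\mathbb{Z}_n\}$ and edges $\{u_i,u_{i+1}\},\{v_i,v_{i+r}\},\{u_i,v_i\},\{u_{i+a},v_i\}$. The canonical double cover $\Gamma\times\mathbf{K}_2$ has vertices $u_{i,j}$, $v_{i,j}$ ($i\in\mathbb{Z}_n$, $j\in\mathbb{Z}_2$) and edges $\{u_{i,j},u_{i+1,j+1}\}$, $\{v_{i,j},v_{i+r,j+1}\}$, $\{u_{i,j},v_{i,j+1}\}$, $\{u_{i+a,j},v_{i,j+1}\}$. Since $n$ is even, the parity of $i\in\mathbb{Z}_n$ is well defined. -}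

module Defs where

open import Data.Nat using (ℕ; zero; suc; _+_; _*_; _%_; NonZero)
open import Data.Nat.DivMod using (m%n<n)
open import Data.Fin using (Fin; toℕ; fromℕ<)
open import Data.Sum using (_⊎_)
open import Data.Product using (∃; _×_)
open import Relation.Binary.PropositionalEquality using (_≡_; _≢_)

_⊕_ : ∀ {n} .{{_ : NonZero n}} → Fin n → ℕ → Fin n
_⊕_ {n} i k = fromℕ< (m%n<n (toℕ i + k) n)

flip2 : Fin 2 → Fin 2
flip2 Fin.zero = Fin.suc Fin.zero
flip2 (Fin.suc _) = Fin.zero

-- vertices of the canonical double cover R_n(a,r) × K₂ :
-- u i j = u_{i,j},  v i j = v_{i,j}
data V (n : ℕ) : Set where
  u : Fin n → Fin 2 → V n
  v : Fin n → Fin 2 → V n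

data Edge (n a r : ℕ) .{{_ : NonZero n}} : V n → V n → Set where
  uu : ∀ i j → Edge n a r (u i j) (u (i ⊕ 1) (flip2 j))
  vv : ∀ i j → Edge n a r (v i j) (v (i ⊕ r) (flip2 j))
  uv : ∀ i j → Edge n a r (u i j) (v i (flip2 j))
  uav : ∀ i j → Edge n a r (u (i ⊕ a) j) (v i (flip2 j))

Adj : (n a r : ℕ) .{{_ : NonZero n}} → V n → V n → Set
Adj n a r x y = Edge n a r x y ⊎ Edge n a r y x

InS2 : ∀ {n} → V n → Set
InS2 {n} x = ∃ λ (i : Fin n) → ∃ λ (j : Fin 2) → (x ≡ u i j) × (toℕ i % 2 ≢ toℕ j)

{-# OPTIONS --safe #-}
-- F fixes S₁ and preserves S₂, so it maps u-vertices to u-vertices and, being a bijection,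
-- v-vertices to v-vertices. The v-neighbours of u_{i,j} are v_{i,j+1} and v_{i-a,j+1}, the
-- u-neighbours of v_{i,j} are u_{i,j+1} and u_{i+a,j+1}, its v-neighbours v_{i±r,j+1}; so a vertex
-- with two fixed neighbours of the same kind is fixed unless n ∣ 2a (resp. n ∣ 4r).
-- For a, r even every v_{i,j} with i ≢ j is fixed by its two u-neighbours in S₁, every other
-- v_{i,j} by v_{i±r,j+1}, and then every u-vertex by its two v-neighbours.
-- For a odd take u_{w+a,t} ∈ S₂, so u_{w,t} ∈ S₁: the common neighbour v_{w,t+1} leaves only
-- F(u_{w+a,t}) = u_{w+a,t} or the twisted F(u_{w+a,t}) = u_{w-a,t}. Under (ii) the twist is
-- refuted through v_{w+a,t+1}, whose other neighbour u_{w+2a,t} is fixed, since 4a ≢ 0; under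
-- (iii) through v_{w+r,t}, since n ∣ 4a and n ∤ 2a make n ∣ 2(a+r) impossible for a + r odd.
-- Once all u-vertices are fixed, so are all v-vertices.
module Submission where

open import Defs
open import Data.Nat using (ℕ; suc; _+_; _*_; _∸_; _%_; _≤_; _<_; NonZero; >-nonZero; s≤s)
open import Data.Nat.Properties using (+-comm; +-assoc; +-identityʳ; *-comm; *-assoc; m+[n∸m]≡n; n≤0⇒n≡0; _≟_)
open import Data.Nat.DivMod using (%-distribˡ-+; %-remove-+ʳ; m%n%n≡m%n; m%n≤n; m%n≤m; m%n<n; n%n≡0; m<n⇒m%n≡m; m∣n⇒o%n%m≡o%m)
open import Data.Nat.Divisibility
open import Data.Nat.Primality using (euclidsLemma; prime[2])
open import Data.Fin using (Fin; toℕ)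
open import Data.Fin.Properties using (toℕ-fromℕ<; toℕ-injective; toℕ<n)
open import Data.Empty using (⊥)
open import Data.Sum using (_⊎_; inj₁; inj₂; [_,_])
open import Data.Product using (∃; ∃₂; _×_; _,_)
open import Relation.Binary.PropositionalEquality using (_≡_; _≢_; refl; sym; trans; cong; cong₂; subst; subst₂; module ≡-Reasoning)
open import Relation.Nullary using (¬_; yes; no; Dec; contradiction)
open import Function.Bundles using (Inverse; Injection; _↔_; _⇔_; Equivalence)
open import Function.Properties.Inverse using (↔⇒↣)

%-congˡ-+ : ∀ {a b} c {n} .{{_ : NonZero n}} → a % n ≡ b % n → (a + c) % n ≡ (b + c) % n
%-congˡ-+ {a} {b} c {n} eq = begin
  (a + c) % n           ≡⟨ %-distribˡ-+ a c n ⟩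
  (a % n + c % n) % n   ≡⟨ cong (λ x → (x + c % n) % n) eq ⟩
  (b % n + c % n) % n   ≡⟨ %-distribˡ-+ b c n ⟨
  (b + c) % n           ∎
  where open ≡-Reasoning

n∣m+[n∸m%n] : ∀ m n .{{_ : NonZero n}} → n ∣ m + (n ∸ m % n)
n∣m+[n∸m%n] m n = m%n≡0⇒n∣m _ n (begin
  (m + (n ∸ m % n)) % n       ≡⟨ %-congˡ-+ (n ∸ m % n) (m%n%n≡m%n m n) ⟨
  (m % n + (n ∸ m % n)) % n   ≡⟨ cong (_% n) (m+[n∸m]≡n (m%n≤n m n)) ⟩
  n % n                       ≡⟨ n%n≡0 n ⟩
  0                           ∎)
  where open ≡-Reasoning

%-cancelʳ-+ : ∀ a b c {n} .{{_ : NonZero n}} → (a + c) % n ≡ (b + c) % n → a % n ≡ b % n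
%-cancelʳ-+ a b c {n} eq = begin
  a % n                  ≡⟨ shift a ⟨
  (a + c + c′) % n       ≡⟨ %-congˡ-+ c′ eq ⟩
  (b + c + c′) % n       ≡⟨ shift b ⟩
  b % n                  ∎
  where
  open ≡-Reasoning
  c′ = n ∸ c % n
  shift : ∀ x → (x + c + c′) % n ≡ x % n
  shift x = trans (cong (_% n) (+-assoc x c c′)) (%-remove-+ʳ x (n∣m+[n∸m%n] c n))

[m+k]%n≡m%n⇒n∣k : ∀ m k {n} .{{_ : NonZero n}} → (m + k) % n ≡ m % n → n ∣ k
[m+k]%n≡m%n⇒n∣k m k {n} eq =
  m%n≡0⇒n∣m k n (trans (%-cancelʳ-+ k 0 m (trans (cong (_% n) (+-comm k m)) eq)) (n≤0⇒n≡0 (m%n≤m 0 n)))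

module _ {n : ℕ} .{{_ : NonZero n}} where

  toℕ-⊕ : (x : Fin n) (k : ℕ) → toℕ (x ⊕ k) ≡ (toℕ x + k) % n
  toℕ-⊕ x k = toℕ-fromℕ< _

  toℕ%n≡toℕ : (x : Fin n) → toℕ x % n ≡ toℕ x
  toℕ%n≡toℕ x = m<n⇒m%n≡m (toℕ<n x)

  ⊕-assoc : (x : Fin n) (k m : ℕ) → (x ⊕ k) ⊕ m ≡ x ⊕ (k + m)
  ⊕-assoc x k m = toℕ-injective (begin
    toℕ ((x ⊕ k) ⊕ m)       ≡⟨ toℕ-⊕ (x ⊕ k) m ⟩
    (toℕ (x ⊕ k) + m) % n   ≡⟨ %-congˡ-+ m (trans (cong (_% n) (toℕ-⊕ x k)) (m%n%n≡m%n _ n)) ⟩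
    (toℕ x + k + m) % n     ≡⟨ cong (_% n) (+-assoc (toℕ x) k m) ⟩
    (toℕ x + (k + m)) % n   ≡⟨ toℕ-⊕ x (k + m) ⟨
    toℕ (x ⊕ (k + m))       ∎)
    where open ≡-Reasoning

  ⊕-swap : (x : Fin n) (k m : ℕ) → (x ⊕ k) ⊕ m ≡ (x ⊕ m) ⊕ k
  ⊕-swap x k m = trans (⊕-assoc x k m) (trans (cong (x ⊕_) (+-comm k m)) (sym (⊕-assoc x m k)))

  ⊕-twice : (x : Fin n) (k : ℕ) → (x ⊕ k) ⊕ k ≡ x ⊕ (2 * k)
  ⊕-twice x k = trans (⊕-assoc x k k) (cong (λ m → x ⊕ (k + m)) (sym (+-identityʳ k)))

  ⊕-cancelʳ : (x y : Fin n) (k : ℕ) → x ⊕ k ≡ y ⊕ k → x ≡ y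
  ⊕-cancelʳ x y k eq = toℕ-injective (begin
    toℕ x       ≡⟨ toℕ%n≡toℕ x ⟨
    toℕ x % n   ≡⟨ %-cancelʳ-+ (toℕ x) (toℕ y) k (trans (sym (toℕ-⊕ x k)) (trans (cong toℕ eq) (toℕ-⊕ y k))) ⟩
    toℕ y % n   ≡⟨ toℕ%n≡toℕ y ⟩
    toℕ y       ∎)
    where open ≡-Reasoning

  ⊕-fixed⇒∣ : (x : Fin n) (k : ℕ) → x ⊕ k ≡ x → n ∣ k
  ⊕-fixed⇒∣ x k eq =
    [m+k]%n≡m%n⇒n∣k (toℕ x) k (trans (sym (toℕ-⊕ x k)) (trans (cong toℕ eq) (sym (toℕ%n≡toℕ x))))

  ⊕-surjective : (s : Fin n) (k : ℕ) → ∃ λ w → w ⊕ k ≡ s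
  ⊕-surjective s k = s ⊕ (n ∸ k % n) , toℕ-injective (begin
    toℕ ((s ⊕ (n ∸ k % n)) ⊕ k)     ≡⟨ cong toℕ (⊕-assoc s _ k) ⟩
    toℕ (s ⊕ ((n ∸ k % n) + k))     ≡⟨ toℕ-⊕ s _ ⟩
    (toℕ s + ((n ∸ k % n) + k)) % n ≡⟨ %-remove-+ʳ (toℕ s) (subst (n ∣_) (+-comm k _) (n∣m+[n∸m%n] k n)) ⟩
    toℕ s % n                        ≡⟨ toℕ%n≡toℕ s ⟩
    toℕ s                            ∎)
    where open ≡-Reasoning

  ⊕-twice-fixed⇒∣ : (x : Fin n) (k : ℕ) → (x ⊕ k) ⊕ k ≡ x → n ∣ 2 * k
  ⊕-twice-fixed⇒∣ x k eq = ⊕-fixed⇒∣ x (2 * k) (trans (sym (⊕-twice x k)) eq)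

  ⊕-4-times-fixed⇒∣ : (x : Fin n) (k : ℕ) → (((x ⊕ k) ⊕ k) ⊕ k) ⊕ k ≡ x → n ∣ 4 * k
  ⊕-4-times-fixed⇒∣ x k eq = subst (n ∣_) (sym (*-assoc 2 2 k))
    (⊕-twice-fixed⇒∣ x (2 * k) (begin
      (x ⊕ (2 * k)) ⊕ (2 * k)   ≡⟨ ⊕-twice (x ⊕ (2 * k)) k ⟨
      ((x ⊕ (2 * k)) ⊕ k) ⊕ k   ≡⟨ cong (λ y → (y ⊕ k) ⊕ k) (⊕-twice x k) ⟨
      (((x ⊕ k) ⊕ k) ⊕ k) ⊕ k   ≡⟨ eq ⟩
      x                         ∎))
    where open ≡-Reasoning

  ⊕-twice-interleaved : (x : Fin n) (k m : ℕ) → (((x ⊕ k) ⊕ m) ⊕ k) ⊕ m ≡ x ⊕ (2 * (k + m))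
  ⊕-twice-interleaved x k m = begin
    (((x ⊕ k) ⊕ m) ⊕ k) ⊕ m     ≡⟨ cong (λ y → (y ⊕ k) ⊕ m) (⊕-assoc x k m) ⟩
    ((x ⊕ (k + m)) ⊕ k) ⊕ m     ≡⟨ ⊕-assoc (x ⊕ (k + m)) k m ⟩
    (x ⊕ (k + m)) ⊕ (k + m)     ≡⟨ ⊕-twice x (k + m) ⟩
    x ⊕ (2 * (k + m))           ∎
    where open ≡-Reasoning

flip2-involutive : ∀ t → flip2 (flip2 t) ≡ t
flip2-involutive Fin.zero = refl
flip2-involutive (Fin.suc Fin.zero) = refl

flip2-injective : ∀ {s t} → flip2 s ≡ flip2 t → s ≡ t
flip2-injective {s} {t} eq = trans (sym (flip2-involutive s)) (trans (cong flip2 eq) (flip2-involutive t))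

flip2-elim : {P : Fin 2 → Set} → (∀ t → P (flip2 t)) → ∀ t → P t
flip2-elim {P} p t = subst P (flip2-involutive t) (p (flip2 t))

toℕ-flip2-≢ : ∀ t → toℕ (flip2 t) ≢ toℕ t
toℕ-flip2-≢ Fin.zero ()
toℕ-flip2-≢ (Fin.suc Fin.zero) ()

<2-dichotomy : ∀ {b} → b < 2 → ∀ t → b ≡ toℕ t ⊎ b ≡ toℕ (flip2 t)
<2-dichotomy {0} _ Fin.zero = inj₁ refl
<2-dichotomy {0} _ (Fin.suc Fin.zero) = inj₂ refl
<2-dichotomy {1} _ Fin.zero = inj₂ refl
<2-dichotomy {1} _ (Fin.suc Fin.zero) = inj₁ refl
<2-dichotomy {suc (suc _)} (s≤s (s≤s ())) _

module _ {n : ℕ} where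

  parity : Fin n → ℕ
  parity i = toℕ i % 2

  Aligned : Fin n → Fin 2 → Set
  Aligned i j = parity i ≡ toℕ j

  aligned? : ∀ i j → Dec (Aligned i j)
  aligned? i j = parity i ≟ toℕ j

  aligned⇒¬aligned-flip2 : ∀ i {t} → Aligned i t → ¬ Aligned i (flip2 t)
  aligned⇒¬aligned-flip2 i {t} al al′ = toℕ-flip2-≢ t (trans (sym al′) al)

  aligned-flip2⇒¬aligned : ∀ i {t} → Aligned i (flip2 t) → ¬ Aligned i t
  aligned-flip2⇒¬aligned i al′ al = aligned⇒¬aligned-flip2 i al al′

  ¬aligned⇒aligned-flip2 : ∀ i {t} → ¬ Aligned i t → Aligned i (flip2 t)
  ¬aligned⇒aligned-flip2 i {t} ¬al with <2-dichotomy (m%n<n (toℕ i) 2) t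
  ... | inj₁ al = contradiction al ¬al
  ... | inj₂ al′ = al′

  ¬aligned-flip2⇒aligned : ∀ i {t} → ¬ Aligned i (flip2 t) → Aligned i t
  ¬aligned-flip2⇒aligned i {t} ¬al′ with <2-dichotomy (m%n<n (toℕ i) 2) t
  ... | inj₁ al = al
  ... | inj₂ al′ = contradiction al′ ¬al′

module Parity {n : ℕ} .{{_ : NonZero n}} (2∣n : 2 ∣ n) where

  parity-⊕ : (x : Fin n) (k : ℕ) → parity (x ⊕ k) ≡ (toℕ x + k) % 2
  parity-⊕ x k = trans (cong (_% 2) (toℕ-⊕ x k)) (m∣n⇒o%n%m≡o%m 2 n (toℕ x + k) 2∣n)

  parity-⊕-even : ∀ {k} → 2 ∣ k → (x : Fin n) → parity (x ⊕ k) ≡ parity x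
  parity-⊕-even {k} 2∣k x = trans (parity-⊕ x k) (%-remove-+ʳ (toℕ x) 2∣k)

  parity-⊕-odd : ∀ {k} → ¬ 2 ∣ k → (x : Fin n) → parity (x ⊕ k) ≢ parity x
  parity-⊕-odd {k} k-odd x eq = k-odd ([m+k]%n≡m%n⇒n∣k (toℕ x) k (trans (sym (parity-⊕ x k)) eq))

  aligned-⊕-odd : ∀ {k} → ¬ 2 ∣ k → ∀ x {t} → Aligned x t → ¬ Aligned (x ⊕ k) t
  aligned-⊕-odd k-odd x al al⊕ = parity-⊕-odd k-odd x (trans al⊕ (sym al))

  ¬aligned-⊕-odd : ∀ {k} → ¬ 2 ∣ k → ∀ x {t} → ¬ Aligned x t → Aligned (x ⊕ k) t
  ¬aligned-⊕-odd {k} k-odd x ¬al = ¬aligned-flip2⇒aligned (x ⊕ k) λ al⊕′ →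
    parity-⊕-odd k-odd x (trans al⊕′ (sym (¬aligned⇒aligned-flip2 x ¬al)))

  ¬aligned-⊕-odd⁻¹ : ∀ {k} → ¬ 2 ∣ k → ∀ x {t} → ¬ Aligned (x ⊕ k) t → Aligned x t
  ¬aligned-⊕-odd⁻¹ k-odd x {t} ¬al⊕ with aligned? x t
  ... | yes al = al
  ... | no ¬al = contradiction (¬aligned-⊕-odd k-odd x ¬al) ¬al⊕

-- With 4a = l n, n ∤ 2a forces l odd, while 4 ∣ l n ∣ l (2m) gives 2 ∣ m l.
n∣4a⇒n∤2a⇒n∣2m⇒2∣m : ∀ {n} a m → n ∣ 4 * a → ¬ n ∣ 2 * a → n ∣ 2 * m → 2 ∣ m
n∣4a⇒n∤2a⇒n∣2m⇒2∣m {n} a m (divides l 4a≡l*n) n∤2a n∣2m with euclidsLemma m l prime[2] 2∣m*l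
  where
  2∣m*l : 2 ∣ m * l
  2∣m*l = *-cancelˡ-∣ 2 (∣-trans (m∣m*n a) (subst₂ _∣_ (sym 4a≡l*n) l*2m≡2*ml (*-monoʳ-∣ l n∣2m)))
    where
    l*2m≡2*ml : l * (2 * m) ≡ 2 * (m * l)
    l*2m≡2*ml = trans (*-comm l (2 * m)) (*-assoc 2 m l)
... | inj₁ 2∣m = 2∣m
... | inj₂ (divides q l≡q*2) = contradiction (*-cancelˡ-∣ 2 2n∣4a) n∤2a
  where
  open ≡-Reasoning
  2n∣4a : 2 * n ∣ 2 * (2 * a)
  2n∣4a = divides q (begin
    2 * (2 * a)   ≡⟨ *-assoc 2 2 a ⟨
    4 * a         ≡⟨ 4a≡l*n ⟩
    l * n         ≡⟨ cong (_* n) l≡q*2 ⟩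
    q * 2 * n     ≡⟨ *-assoc q 2 n ⟩
    q * (2 * n)   ∎)

n∤4a⇒n∤2a : ∀ {n} a → ¬ n ∣ 4 * a → ¬ n ∣ 2 * a
n∤4a⇒n∤2a a n∤4a n∣2a = n∤4a (∣-trans n∣2a (*-monoˡ-∣ {m = 2} {n = 4} a (divides 2 refl)))

module _ {n a r : ℕ} .{{_ : NonZero n}} where

  adj-uv-shape : ∀ {i j p q} → Adj n a r (u i j) (v p q) → q ≡ flip2 j × (i ≡ p ⊎ i ≡ p ⊕ a)
  adj-uv-shape (inj₁ (uv _ _)) = refl , inj₁ refl
  adj-uv-shape (inj₁ (uav _ _)) = refl , inj₂ refl
  adj-uv-shape (inj₂ ())

  adj-vv-shape : ∀ {i j p q} → Adj n a r (v i j) (v p q) → q ≡ flip2 j × (p ≡ i ⊕ r ⊎ i ≡ p ⊕ r)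
  adj-vv-shape (inj₁ (vv _ _)) = refl , inj₁ refl
  adj-vv-shape (inj₂ (vv _ q)) = sym (flip2-involutive q) , inj₂ refl

module Rigidity {n a r : ℕ} .{{_ : NonZero n}} (2∣n : 2 ∣ n)
  (F : V n → V n)
  (F-injective : ∀ {x y} → F x ≡ F y → x ≡ y)
  (F-adj : ∀ {x y} → Adj n a r x y → Adj n a r (F x) (F y))
  (F-fixes-S₁ : ∀ i j → Aligned i j → F (u i j) ≡ u i j)
  (F-maps-S₂ : ∀ x → InS2 x → InS2 (F x))
  (F-onto-S₂ : ∀ y → InS2 y → ∃ λ x → InS2 x × F x ≡ y) where

  open Parity 2∣n

  Fixed : V n → Set
  Fixed x = F x ≡ x

  F-adj-to : ∀ {x y x′ y′} → Adj n a r x y → F x ≡ x′ → F y ≡ y′ → Adj n a r x′ y′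
  F-adj-to e refl refl = F-adj e

  u↦u : ∀ i j → ∃₂ λ p q → F (u i j) ≡ u p q
  u↦u i j with aligned? i j
  ... | yes al = i , j , F-fixes-S₁ i j al
  ... | no ¬al with F-maps-S₂ (u i j) (i , j , refl , ¬al)
  ...   | p , q , e , _ = p , q , e

  v↦v : ∀ i j → ∃₂ λ p q → F (v i j) ≡ v p q
  v↦v i j with F (v i j) in e
  ... | v p q = p , q , refl
  ... | u p q with aligned? p q
  ...   | yes al with () ← F-injective (trans e (sym (F-fixes-S₁ p q al)))
  ...   | no ¬al with F-onto-S₂ (u p q) (p , q , refl , ¬al)
  ...     | _ , (_ , _ , refl , _) , e′ with () ← F-injective (trans e (sym e′))

  fixed-everywhere : (∀ i j → Fixed (u i j)) → (∀ i j → Fixed (v i j)) → ∀ x → Fixed x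
  fixed-everywhere fix-u fix-v (u i j) = fix-u i j
  fixed-everywhere fix-u fix-v (v i j) = fix-v i j

  v-fixed-by-u : ¬ n ∣ 2 * a → ∀ {i t} → Fixed (u i t) → Fixed (u (i ⊕ a) t) → Fixed (v i (flip2 t))
  v-fixed-by-u n∤2a {i} {t} fix₁ fix₂ with v↦v i (flip2 t)
  ... | p , q , e with adj-uv-shape (F-adj-to (inj₁ (uv i t)) fix₁ e)
                     | adj-uv-shape (F-adj-to (inj₁ (uav i t)) fix₂ e)
  ... | q≡ , inj₁ i≡p | _ = trans e (cong₂ v (sym i≡p) q≡)
  ... | q≡ , inj₂ i≡p⊕a | _ , inj₂ i⊕a≡p⊕a = trans e (cong₂ v (sym (⊕-cancelʳ i p a i⊕a≡p⊕a)) q≡)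
  ... | _ , inj₂ i≡p⊕a | _ , inj₁ i⊕a≡p =
    contradiction (⊕-twice-fixed⇒∣ p a (trans (cong (_⊕ a) (sym i≡p⊕a)) i⊕a≡p)) n∤2a

  u-fixed-by-v : ¬ n ∣ 2 * a → ∀ {w t} → Fixed (v w (flip2 t)) → Fixed (v (w ⊕ a) (flip2 t)) →
    Fixed (u (w ⊕ a) t)
  u-fixed-by-v n∤2a {w} {t} fix₁ fix₂ with u↦u (w ⊕ a) t
  ... | p , q , e with adj-uv-shape (F-adj-to (inj₁ (uav w t)) e fix₁)
                     | adj-uv-shape (F-adj-to (inj₁ (uv (w ⊕ a) t)) e fix₂)
  ... | t≡ , _ | _ , inj₁ p≡w⊕a = trans e (cong₂ u p≡w⊕a (flip2-injective (sym t≡)))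
  ... | _ , inj₁ p≡w | _ , inj₂ p≡w⊕a⊕a =
    contradiction (⊕-twice-fixed⇒∣ w a (trans (sym p≡w⊕a⊕a) p≡w)) n∤2a
  ... | t≡ , inj₂ p≡w⊕a | _ , inj₂ _ = trans e (cong₂ u p≡w⊕a (flip2-injective (sym t≡)))

  v-fixed-by-v : ¬ n ∣ 4 * r → ∀ {w t} → Fixed (v w t) → Fixed (v ((w ⊕ r) ⊕ r) (flip2 (flip2 t))) →
    Fixed (v (w ⊕ r) (flip2 t))
  v-fixed-by-v n∤4r {w} {t} fix₁ fix₂ with v↦v (w ⊕ r) (flip2 t)
  ... | p , q , e with adj-vv-shape (F-adj-to (inj₁ (vv w t)) fix₁ e)
                     | adj-vv-shape (F-adj-to (inj₁ (vv (w ⊕ r) (flip2 t))) e fix₂)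
  ... | q≡ , inj₁ p≡w⊕r | _ = trans e (cong₂ v p≡w⊕r q≡)
  ... | q≡ , inj₂ _ | _ , inj₁ w⊕r⊕r≡p⊕r = trans e (cong₂ v (sym (⊕-cancelʳ (w ⊕ r) p r w⊕r⊕r≡p⊕r)) q≡)
  ... | _ , inj₂ w≡p⊕r | _ , inj₂ p≡w⊕r⊕r⊕r =
    contradiction (⊕-4-times-fixed⇒∣ w r (trans (cong (_⊕ r) (sym p≡w⊕r⊕r⊕r)) (sym w≡p⊕r))) n∤4r

  v-fixed⇒u-fixed : ¬ n ∣ 2 * a → (∀ i j → Fixed (v i j)) → ∀ s t → Fixed (u s t)
  v-fixed⇒u-fixed n∤2a fix-v s t with ⊕-surjective s a
  ... | w , refl = u-fixed-by-v n∤2a (fix-v w (flip2 t)) (fix-v (w ⊕ a) (flip2 t))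

  u-fixed⇒v-fixed : ¬ n ∣ 2 * a → (∀ i j → Fixed (u i j)) → ∀ i j → Fixed (v i j)
  u-fixed⇒v-fixed n∤2a fix-u i = flip2-elim λ t → v-fixed-by-u n∤2a (fix-u i t) (fix-u (i ⊕ a) t)

  fixes-all-even : 2 ∣ a → 2 ∣ r → ¬ n ∣ 2 * a → ¬ n ∣ 4 * r → ∀ x → Fixed x
  fixes-all-even 2∣a 2∣r n∤2a n∤4r = fixed-everywhere (v-fixed⇒u-fixed n∤2a fix-v) fix-v
    where
    misaligned-fixed : ∀ i j → ¬ Aligned i j → Fixed (v i j)
    misaligned-fixed i = flip2-elim λ t ¬al′ → let al = ¬aligned-flip2⇒aligned i ¬al′ in
      v-fixed-by-u n∤2a (F-fixes-S₁ i t al) (F-fixes-S₁ (i ⊕ a) t (trans (parity-⊕-even 2∣a i) al))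

    aligned-fixed : ∀ w t → Aligned (w ⊕ r) (flip2 t) → Fixed (v (w ⊕ r) (flip2 t))
    aligned-fixed w t al = v-fixed-by-v n∤4r
      (misaligned-fixed w t (aligned-flip2⇒¬aligned w (trans (sym (parity-⊕-even 2∣r w)) al)))
      (misaligned-fixed ((w ⊕ r) ⊕ r) (flip2 (flip2 t))
        (aligned⇒¬aligned-flip2 ((w ⊕ r) ⊕ r) (trans (parity-⊕-even 2∣r (w ⊕ r)) al)))

    fix-v : ∀ i j → Fixed (v i j)
    fix-v i j with aligned? i j | ⊕-surjective i r
    ... | no ¬al | _ = misaligned-fixed i j ¬al
    ... | yes al | w , refl =
      flip2-elim {λ j → Aligned (w ⊕ r) j → Fixed (v (w ⊕ r) j)} (aligned-fixed w) j al

  -- The only alternative to F fixing u_{w+a,t} left by fixed-or-twisted: u_{w+a,t} and v_{w,t+1}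
  -- are moved down by 2a and by a.
  Twisted : Fin n → Fin 2 → Set
  Twisted w t = ∃ λ x → w ≡ x ⊕ a × ¬ Aligned x t ×
    F (u (w ⊕ a) t) ≡ u x t × F (v w (flip2 t)) ≡ v x (flip2 t)

  fixed-or-twisted : ¬ 2 ∣ a → ∀ {w t} → Aligned w t → Fixed (u (w ⊕ a) t) ⊎ Twisted w t
  fixed-or-twisted a-odd {w} {t} al
    with F-maps-S₂ (u (w ⊕ a) t) (w ⊕ a , t , refl , aligned-⊕-odd a-odd w al) | v↦v w (flip2 t)
  ... | p , q , e , ¬al-pq | x , y , e′
    with adj-uv-shape (F-adj-to (inj₁ (uv w t)) (F-fixes-S₁ w t al) e′)
       | adj-uv-shape (F-adj-to (inj₁ (uav w t)) e e′)
  ... | y≡ , w-side | y≡′ , p-side with flip2-injective (trans (sym y≡′) y≡)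
  ... | refl = decide w-side p-side
    where
    p≢w : p ≢ w
    p≢w p≡w = ¬al-pq (subst (λ z → Aligned z q) (sym p≡w) al)

    decide : (w ≡ x ⊎ w ≡ x ⊕ a) → (p ≡ x ⊎ p ≡ x ⊕ a) → Fixed (u (w ⊕ a) q) ⊎ Twisted w q
    decide (inj₁ w≡x) (inj₁ p≡x) = contradiction (trans p≡x (sym w≡x)) p≢w
    decide (inj₂ w≡x⊕a) (inj₂ p≡x⊕a) = contradiction (trans p≡x⊕a (sym w≡x⊕a)) p≢w
    decide (inj₁ w≡x) (inj₂ p≡x⊕a) = inj₁ (trans e (cong (λ z → u z q) (trans p≡x⊕a (cong (_⊕ a) (sym w≡x)))))
    decide (inj₂ w≡x⊕a) (inj₁ p≡x) = inj₂ (x , w≡x⊕a , subst (λ z → ¬ Aligned z q) p≡x ¬al-pq ,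
      trans e (cong (λ z → u z q) p≡x) , trans e′ (cong (v x) y≡))

  fixes-all-odd : ¬ 2 ∣ a → ¬ n ∣ 2 * a → (∀ {w t} → Aligned w t → ¬ Twisted w t) → ∀ x → Fixed x
  fixes-all-odd a-odd n∤2a ¬twisted = fixed-everywhere fix-u (u-fixed⇒v-fixed n∤2a fix-u)
    where
    fix-u : ∀ s t → Fixed (u s t)
    fix-u s t with aligned? s t | ⊕-surjective s a
    ... | yes al | _ = F-fixes-S₁ s t al
    ... | no ¬al | w , refl with fixed-or-twisted a-odd (¬aligned-⊕-odd⁻¹ a-odd w ¬al)
    ...   | inj₁ fixed = fixed
    ...   | inj₂ twisted = contradiction twisted (¬twisted (¬aligned-⊕-odd⁻¹ a-odd w ¬al))

  ¬twisted-II : ¬ 2 ∣ a → ¬ n ∣ 4 * a → ∀ {w t} → Aligned w t → ¬ Twisted w t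
  ¬twisted-II a-odd n∤4a {t = t} al (x , refl , ¬al-x , e-u , _)
    with al₃ ← ¬aligned-⊕-odd a-odd ((x ⊕ a) ⊕ a) (aligned-⊕-odd a-odd (x ⊕ a) al)
       | v↦v ((x ⊕ a) ⊕ a) (flip2 t)
  ... | y , _ , e with adj-uv-shape (F-adj-to (inj₁ (uv ((x ⊕ a) ⊕ a) t)) e-u e)
                     | adj-uv-shape (F-adj-to (inj₁ (uav ((x ⊕ a) ⊕ a) t)) (F-fixes-S₁ _ t al₃) e)
  ... | _ , x-side | _ , fixed-side = decide x-side fixed-side
    where
    x≢ : x ≢ ((x ⊕ a) ⊕ a) ⊕ a
    x≢ x≡ = ¬al-x (subst (λ z → Aligned z t) (sym x≡) al₃)

    decide : (x ≡ y ⊎ x ≡ y ⊕ a) → (((x ⊕ a) ⊕ a) ⊕ a ≡ y ⊎ ((x ⊕ a) ⊕ a) ⊕ a ≡ y ⊕ a) → ⊥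
    decide (inj₁ x≡y) (inj₁ e₂) = x≢ (trans x≡y (sym e₂))
    decide (inj₂ x≡y⊕a) (inj₂ e₂) = x≢ (trans x≡y⊕a (cong (_⊕ a) (sym (⊕-cancelʳ _ _ a e₂))))
    decide (inj₁ x≡y) (inj₂ e₂) =
      n∤4a⇒n∤2a a n∤4a (⊕-twice-fixed⇒∣ x a (trans (⊕-cancelʳ _ _ a e₂) (sym x≡y)))
    decide (inj₂ x≡y⊕a) (inj₁ e₂) =
      n∤4a (⊕-4-times-fixed⇒∣ x a (sym (trans x≡y⊕a (cong (_⊕ a) (sym e₂)))))

  ¬twisted-III : ¬ 2 ∣ a → 2 ∣ r → 0 < a → a < n → n ∣ 4 * a → ¬ n ∣ 2 * a →
    ∀ {w t} → Aligned w t → ¬ Twisted w t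
  ¬twisted-III a-odd 2∣r 0<a a<n n∣4a n∤2a {t = t} al (x , refl , _ , _ , e-v)
    with al′ ← ¬aligned⇒aligned-flip2 (((x ⊕ a) ⊕ r) ⊕ a)
                 (aligned-⊕-odd a-odd ((x ⊕ a) ⊕ r) (trans (parity-⊕-even 2∣r (x ⊕ a)) al))
       | v↦v ((x ⊕ a) ⊕ r) (flip2 (flip2 t))
  ... | z , _ , e with adj-uv-shape (F-adj-to (inj₁ (uav ((x ⊕ a) ⊕ r) (flip2 t))) (F-fixes-S₁ _ _ al′) e)
                     | adj-vv-shape (F-adj-to (inj₁ (vv (x ⊕ a) (flip2 t))) e-v e)
  ... | _ , fixed-side | _ , x-side = decide fixed-side x-side
    where
    n∤a : ¬ n ∣ a
    n∤a = >⇒∤ {{>-nonZero 0<a}} a<n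

    n∤a+2r : ¬ n ∣ a + 2 * r
    n∤a+2r n∣a+2r = a-odd (∣m+n∣m⇒∣n (subst (2 ∣_) (+-comm a (2 * r)) (∣-trans 2∣n n∣a+2r)) (m∣m*n r))

    n∤2⟨a+r⟩ : ¬ n ∣ 2 * (a + r)
    n∤2⟨a+r⟩ n∣2⟨a+r⟩ = a-odd (∣m+n∣m⇒∣n
      (subst (2 ∣_) (+-comm a r) (n∣4a⇒n∤2a⇒n∣2m⇒2∣m a (a + r) n∣4a n∤2a n∣2⟨a+r⟩)) 2∣r)

    decide : (((x ⊕ a) ⊕ r) ⊕ a ≡ z ⊎ ((x ⊕ a) ⊕ r) ⊕ a ≡ z ⊕ a) → (z ≡ x ⊕ r ⊎ x ≡ z ⊕ r) → ⊥
    decide (inj₁ e₁) (inj₁ e₂) =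
      n∤2a (⊕-twice-fixed⇒∣ (x ⊕ r) a (trans (cong (_⊕ a) (⊕-swap x r a)) (trans e₁ e₂)))
    decide (inj₁ e₁) (inj₂ e₂) =
      n∤2⟨a+r⟩ (⊕-fixed⇒∣ x _ (sym (trans e₂ (trans (cong (_⊕ r) (sym e₁)) (⊕-twice-interleaved x a r)))))
    decide (inj₂ e₁) (inj₁ e₂) =
      n∤a (⊕-fixed⇒∣ (x ⊕ r) a (trans (⊕-swap x r a) (trans (⊕-cancelʳ _ _ a e₁) e₂)))
    decide (inj₂ e₁) (inj₂ e₂) =
      n∤a+2r (⊕-fixed⇒∣ x _ (sym (trans e₂ (trans (cong (_⊕ r) (sym (⊕-cancelʳ _ _ a e₁)))
        (trans (⊕-twice (x ⊕ a) r) (⊕-assoc x a (2 * r)))))))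

lemma3p4 : (n a r : ℕ) .{{_ : NonZero n}} → 3 ≤ n → 2 ∣ n →
    1 ≤ a → a < n → 1 ≤ r → r < n →
    ((2 ∣ a × 2 ∣ r × ¬ (n ∣ 2 * a) × ¬ (n ∣ 4 * r))
      ⊎ (¬ (2 ∣ a) × ¬ (n ∣ 4 * a))
      ⊎ (¬ (2 ∣ a) × n ∣ 4 * a × ¬ (n ∣ 2 * a) × 2 ∣ r)) →
    (f : V n ↔ V n) →
    (∀ x y → Adj n a r x y ⇔ Adj n a r (Inverse.to f x) (Inverse.to f y)) →
    (∀ (i : Fin n) (j : Fin 2) → toℕ i % 2 ≡ toℕ j → Inverse.to f (u i j) ≡ u i j) →
    (∀ x → InS2 x → InS2 (Inverse.to f x)) →
    (∀ y → InS2 y → ∃ λ x → InS2 x × Inverse.to f x ≡ y) →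
    ∀ x → Inverse.to f x ≡ x
lemma3p4 n a r _ 2∣n 0<a a<n _ _ cases f adj fixes-S₁ into-S₂ onto-S₂ =
  [ (λ (2∣a , 2∣r , n∤2a , n∤4r) → fixes-all-even 2∣a 2∣r n∤2a n∤4r)
  , [ (λ (a-odd , n∤4a) → fixes-all-odd a-odd (n∤4a⇒n∤2a a n∤4a) (¬twisted-II a-odd n∤4a))
    , (λ (a-odd , n∣4a , n∤2a , 2∣r) →
         fixes-all-odd a-odd n∤2a (¬twisted-III a-odd 2∣r 0<a a<n n∣4a n∤2a))
    ] ] cases
  where
  open Rigidity 2∣n (Inverse.to f) (Injection.injective (↔⇒↣ f)) (λ {x} {y} → Equivalence.to (adj x y))
    fixes-S₁ into-S₂ onto-S₂
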